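{- Let $\mathcal{G}$ be an ordered group such that for every $g\in\mathcal{G}\setminus\{1\}$ the centraliser $\mathcal{C}(g)$, with the induced ordering, is an Archimedean ordered group. Then for all $f,g\in\mathcal{G}$ with $f\geqslant g>1$ and every $g_0\in\mathcal{C}(g)$, there is an $f_0\in\mathcal{C}(f)$ with $f_0\geqslant g_0$.
   Context: An ordered group is a group $(\mathcal{G},\cdot,1)$ with a linear order $<$ such that $g>h$ implies $fg>fh$ and $gf>hf$ for all $f$. $\mathcal{C}(g)=\{h\in\mathcal{G}: hg=gh\}$. An ordered group is Archimedean if for all non-identity $f,g$ there is $n\in\mathbb{Z}$ with $f^n\geqslant g$. -}

module Defs where

open import Level using (Level; suc; _⊔_)
open import Data.Nat using (ℕ; zero) renaming (suc to sucℕ)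
open import Data.Integer using (ℤ; +_; -[1+_])
open import Data.Product using (∃; _×_)
open import Data.Sum using (_⊎_)
open import Relation.Nullary using (¬_)
open import Relation.Binary.Structures using (IsStrictTotalOrder)
open import Algebra.Bundles using (Group)

record OrderedGroup (c ℓ₁ ℓ₂ : Level) : Set (suc (c ⊔ ℓ₁ ⊔ ℓ₂)) where
  field
    group : Group c ℓ₁
  open Group group public
  field
    _<_ : Carrier → Carrier → Set ℓ₂
    isStrictTotalOrder : IsStrictTotalOrder _≈_ _<_
    <-compatˡ : ∀ f {g h} → h < g → (f ∙ h) < (f ∙ g)
    <-compatʳ : ∀ f {g h} → h < g → (h ∙ f) < (g ∙ f)

  infix 4 _≤_
  _≤_ : Carrier → Carrier → Set (ℓ₁ ⊔ ℓ₂)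
  x ≤ y = (x < y) ⊎ (x ≈ y)

  _^ℕ_ : Carrier → ℕ → Carrier
  x ^ℕ zero = ε
  x ^ℕ sucℕ n = x ∙ (x ^ℕ n)

  _^ℤ_ : Carrier → ℤ → Carrier
  x ^ℤ (+ n) = x ^ℕ n
  x ^ℤ -[1+ n ] = (x ⁻¹) ^ℕ sucℕ n

  InCentraliser : Carrier → Carrier → Set ℓ₁
  InCentraliser g h = (h ∙ g) ≈ (g ∙ h)

  ArchimedeanCentraliser : Carrier → Set (c ⊔ ℓ₁ ⊔ ℓ₂)
  ArchimedeanCentraliser g =
    ∀ f h → InCentraliser g f → InCentraliser g h →
    ¬ (f ≈ ε) → ¬ (h ≈ ε) → ∃ λ (n : ℤ) → h ≤ (f ^ℤ n)

{-# OPTIONS --safe #-}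
module Submission where

-- If g₀ ≤ 1 then f₀ = 1 works. Otherwise the Archimedean property of C(g)
-- gives g₀ ≤ gⁿ for some n ∈ ℤ; for n < 0 we have gⁿ < 1, and for n ≥ 0
-- monotonicity of powers gives gⁿ ≤ fⁿ ∈ C(f).

open import Defs
open import Level using (Level)
open import Data.Product using (∃; _×_; _,_)
open import Data.Sum using (_⊎_; inj₁; inj₂)
open import Data.Nat using (zero) renaming (suc to sucℕ)
open import Data.Integer using (+_; -[1+_])
open import Relation.Nullary using (¬_)
open import Relation.Binary.Definitions using (tri<; tri≈; tri>)
open import Relation.Binary.Structures using (IsStrictTotalOrder; IsTotalOrder)
import Relation.Binary.Construct.StrictToNonStrict as StrictToNonStrict
import Relation.Binary.Reasoning.Setoid as SetoidReasoning

module OrderedGroupProperties {c ℓ₁ ℓ₂ : Level} (G : OrderedGroup c ℓ₁ ℓ₂) where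
  open OrderedGroup G
  open IsStrictTotalOrder isStrictTotalOrder using (compare; irrefl; <-respʳ-≈; <-respˡ-≈)
  open IsTotalOrder (StrictToNonStrict.isTotalOrder _≈_ _<_ isStrictTotalOrder)
    public using () renaming (trans to ≤-trans)
  open SetoidReasoning setoid

  ∙-monoʳ-≤ : ∀ f {g h} → h ≤ g → (f ∙ h) ≤ (f ∙ g)
  ∙-monoʳ-≤ f (inj₁ h<g) = inj₁ (<-compatˡ f h<g)
  ∙-monoʳ-≤ f (inj₂ h≈g) = inj₂ (∙-cong refl h≈g)

  ∙-monoˡ-≤ : ∀ f {g h} → h ≤ g → (h ∙ f) ≤ (g ∙ f)
  ∙-monoˡ-≤ f (inj₁ h<g) = inj₁ (<-compatʳ f h<g)
  ∙-monoˡ-≤ f (inj₂ h≈g) = inj₂ (∙-cong h≈g refl)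

  ∙-mono-≤ : ∀ {g₁ g₂ h₁ h₂} → g₁ ≤ g₂ → h₁ ≤ h₂ → (g₁ ∙ h₁) ≤ (g₂ ∙ h₂)
  ∙-mono-≤ {g₁} g₁≤g₂ h₁≤h₂ = ≤-trans (∙-monoʳ-≤ g₁ h₁≤h₂) (∙-monoˡ-≤ _ g₁≤g₂)

  ^ℕ-monoˡ-≤ : ∀ {g f} → g ≤ f → ∀ k → (g ^ℕ k) ≤ (f ^ℕ k)
  ^ℕ-monoˡ-≤ g≤f zero     = inj₂ refl
  ^ℕ-monoˡ-≤ g≤f (sucℕ k) = ∙-mono-≤ g≤f (^ℕ-monoˡ-≤ g≤f k)

  ^ℕ-≤ε : ∀ {g} → g ≤ ε → ∀ k → (g ^ℕ k) ≤ ε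
  ^ℕ-≤ε g≤ε zero     = inj₂ refl
  ^ℕ-≤ε g≤ε (sucℕ k) = ≤-trans (∙-mono-≤ g≤ε (^ℕ-≤ε g≤ε k)) (inj₂ (identityˡ ε))

  ⁻¹-<ε : ∀ {g} → ε < g → (g ⁻¹) < ε
  ⁻¹-<ε {g} ε<g =
    <-respʳ-≈ (inverseˡ g) (<-respˡ-≈ (identityʳ (g ⁻¹)) (<-compatˡ (g ⁻¹) ε<g))

  ε-inCentraliser : ∀ f → InCentraliser f ε
  ε-inCentraliser f = trans (identityˡ f) (sym (identityʳ f))

  ^ℕ-inCentraliser : ∀ f k → InCentraliser f (f ^ℕ k)
  ^ℕ-inCentraliser f zero     = ε-inCentraliser f
  ^ℕ-inCentraliser f (sucℕ k) = begin
    (f ∙ (f ^ℕ k)) ∙ f ≈⟨ assoc f (f ^ℕ k) f ⟩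
    f ∙ ((f ^ℕ k) ∙ f) ≈⟨ ∙-cong refl (^ℕ-inCentraliser f k) ⟩
    f ∙ (f ∙ (f ^ℕ k)) ∎

  ^ℤ-boundedInCentraliser : ∀ {f g} → ε < g → g ≤ f → ∀ n →
    ∃ λ f₀ → InCentraliser f f₀ × (g ^ℤ n) ≤ f₀
  ^ℤ-boundedInCentraliser {f} ε<g g≤f (+ k) =
    f ^ℕ k , ^ℕ-inCentraliser f k , ^ℕ-monoˡ-≤ g≤f k
  ^ℤ-boundedInCentraliser {f} ε<g g≤f -[1+ k ] =
    ε , ε-inCentraliser f , ^ℕ-≤ε (inj₁ (⁻¹-<ε ε<g)) (sucℕ k)

  ε<⇒≉ε : ∀ {g} → ε < g → ¬ (g ≈ ε)
  ε<⇒≉ε ε<g g≈ε = irrefl (sym g≈ε) ε<g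

  ≤ε⊎ε< : ∀ g → g ≤ ε ⊎ ε < g
  ≤ε⊎ε< g with compare g ε
  ... | tri< g<ε _ _ = inj₁ (inj₁ g<ε)
  ... | tri≈ _ g≈ε _ = inj₁ (inj₂ g≈ε)
  ... | tri> _ _ ε<g = inj₂ ε<g

proposition2p1 : ∀ {c ℓ₁ ℓ₂ : Level} (G : OrderedGroup c ℓ₁ ℓ₂) →
    let open OrderedGroup G in
    (∀ g → ¬ (g ≈ ε) → ArchimedeanCentraliser g) →
    ∀ f g → g ≤ f → ε < g → ∀ g₀ → InCentraliser g g₀ →
    ∃ λ f₀ → InCentraliser f f₀ × g₀ ≤ f₀
proposition2p1 G archimedean f g g≤f ε<g g₀ g₀∈C[g]
  with OrderedGroupProperties.≤ε⊎ε< G g₀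
... | inj₁ g₀≤ε = _ , ε-inCentraliser f , g₀≤ε
  where open OrderedGroupProperties G
... | inj₂ ε<g₀ =
  let g≉ε = ε<⇒≉ε ε<g
      n , g₀≤gⁿ = archimedean g g≉ε g g₀ refl g₀∈C[g] g≉ε (ε<⇒≉ε ε<g₀)
      f₀ , f₀∈C[f] , gⁿ≤f₀ = ^ℤ-boundedInCentraliser ε<g g≤f n
  in f₀ , f₀∈C[f] , ≤-trans g₀≤gⁿ gⁿ≤f₀
  where
    open OrderedGroup G
    open OrderedGroupProperties G
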